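{- For all positive integers $n,k,\ell$ with $k\ge \ell$, \[ \frac{n^k}{\ell(n-1)+1}\le a_{n,k,\ell}\le n^{k-1}. \]
   Context: Let $H_{n,k}=\{0,1,\dots,n-1\}^k$ (the $k$-dimensional hypercube of side length $n$). For $\ell\le k$, an $\ell$-rook is a point $P\in H_{n,k}$ together with a set $D$ of $\ell$ of the $k$ coordinate indices; it covers (attacks) the point $P$ itself and every point of $H_{n,k}$ which differs from $P$ in exactly one coordinate, that coordinate belonging to $D$. Distinct rooks must occupy distinct points. $a_{n,k,\ell}$ is the minimum number of $\ell$-rooks whose covered sets together cover all of $H_{n,k}$. -}

module Defs where

open import Data.Nat using (ℕ; _≤_)
open import Data.Fin using (Fin)
open import Data.Fin.Subset using (Subset; _∈_; ∣_∣)
open import Data.Vec using (Vec; lookup)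
open import Data.List using (List; length; map)
open import Data.List.Relation.Unary.Unique.Propositional using (Unique)
open import Data.List.Relation.Unary.Any using (Any)
open import Data.Product using (Σ; ∃; _×_; _,_; proj₁)
open import Data.Sum using (_⊎_)
open import Relation.Binary.PropositionalEquality using (_≡_; _≢_)

Point : ℕ → ℕ → Set
Point n k = Vec (Fin n) k

record Rook (n k ℓ : ℕ) : Set where
  constructor rook
  field
    pos  : Point n k
    dirs : Subset k
    size : ∣ dirs ∣ ≡ ℓ
open Rook public

Covers : ∀ {n k ℓ} → Rook n k ℓ → Point n k → Set
Covers r Q =
  (Q ≡ pos r) ⊎
  (∃ λ (i : Fin _) → (i ∈ dirs r) × (lookup Q i ≢ lookup (pos r) i)
                   × (∀ j → j ≢ i → lookup Q j ≡ lookup (pos r) j))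

IsCovering : ∀ {n k ℓ} → List (Rook n k ℓ) → Set
IsCovering {n} {k} rs =
  Unique (map pos rs) × (∀ (Q : Point n k) → Any (λ r → Covers r Q) rs)

-- m is a_{n,k,ℓ}: the minimum number of ℓ-rooks in a covering configuration
IsMinCover : ℕ → ℕ → ℕ → ℕ → Set
IsMinCover n k ℓ m =
  (Σ (List (Rook n k ℓ)) λ rs → IsCovering rs × length rs ≡ m) ×
  (∀ (rs : List (Rook n k ℓ)) → IsCovering rs → m ≤ length rs)

-- An ℓ-rook covers its own point and the n − 1 other points on each of its ℓ lines,
-- hence at most ℓ(n − 1) + 1 points, and counting the points covered by a covering
-- gives the lower bound. For the upper bound, place a rook on every point of the face
-- x₀ = 0 with coordinate 0 among its directions: it covers the whole line through it
-- in direction 0, and these n^(k−1) lines partition the hypercube. Since everything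
-- is finite, whether a covering of a given size exists is decidable, so a least size
-- a_{n,k,ℓ} exists.
module Submission where

open import Defs
open import Data.Nat using (ℕ; suc; _≤_; _*_; _+_; _∸_; _^_)
open import Data.Product using (∃; _×_)

open import Level using (0ℓ)
open import Function using (_∘_; Injective)
open import Data.Nat as ℕ using (zero; _<_; s≤s)
open import Data.Nat.Properties using (≮⇒≥; suc-injective; +-comm; ≡-irrelevant; ≤-trans; ≤-reflexive; n<1+n; m<1+n⇒m<n∨m≡n)
open import Data.Fin as Fin using (Fin; combine; funToFin; finToFun; punchIn; punchOut; _≟_)
open import Data.Fin.Properties using (any?; all?; injective⇒≤; finToFun-funToFin; funToFin-finToFin; punchIn-punchOut)
open import Data.Fin.Subset using (Subset; inside; outside; ⊥) renaming (_∈_ to _∈ₛ_; ∣_∣ to card)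
open import Data.Fin.Subset.Properties using (∣⊥∣≡0; anySubset?) renaming (_∈?_ to _∈ₛ?_)
open import Data.Vec as Vec using (Vec; []; _∷_; lookup; tabulate; _[_]≔_)
open import Data.Vec.Properties using (lookup∘tabulate; tabulate∘lookup; tabulate-cong; lookup∘update; lookup∘update′; ∷-injectiveʳ; ≡-dec)
open import Data.List as List using (List; []; _∷_; length; map; concatMap; allFin)
open import Data.List.Properties using (length-map; length-tabulate; length-++; map-∘)
open import Data.List.Relation.Unary.Any as Any using (Any; here; there; satisfied)
open import Data.List.Relation.Unary.Any.Properties using (lookup-index)
open import Data.List.Membership.Propositional using (_∈_; lose)
open import Data.List.Membership.Propositional.Properties using (∈-map⁺; ∈-allFin; ∈-concatMap⁺)
open import Data.List.Relation.Unary.Unique.Propositional using (Unique)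
open import Data.List.Relation.Unary.Unique.Propositional.Properties using (allFin⁺) renaming (map⁺ to Unique-map⁺)
import Data.List.Relation.Unary.Unique.DecPropositional as UniqueDec
open import Data.Product using (Σ; _,_; proj₁)
open import Data.Sum using (_⊎_; inj₁; inj₂)
open import Relation.Nullary using (Dec; yes; no; ¬_; contradiction)
open import Relation.Nullary.Decidable using (_×-dec_; _⊎-dec_; _→-dec_; ¬?; map′; decidable-stable)
open import Relation.Unary using (Pred; Decidable)
open import Relation.Binary.PropositionalEquality using (_≡_; _≢_; _≗_; refl; sym; trans; cong; cong₂; subst; module ≡-Reasoning)

funToFin-cong : ∀ {m n} {f g : Fin m → Fin n} → f ≗ g → funToFin f ≡ funToFin g
funToFin-cong {zero}  _   = refl
funToFin-cong {suc m} f≗g = cong₂ combine (f≗g Fin.zero) (funToFin-cong (f≗g ∘ Fin.suc))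

module _ {n k : ℕ} where

  pointToFin : Point n k → Fin (n ^ k)
  pointToFin P = funToFin (lookup P)

  finToPoint : Fin (n ^ k) → Point n k
  finToPoint i = tabulate (finToFun {n} {k} i)

  finToPoint-pointToFin : ∀ P → finToPoint (pointToFin P) ≡ P
  finToPoint-pointToFin P = trans (tabulate-cong (finToFun-funToFin (lookup P))) (tabulate∘lookup P)

  finToPoint-injective : Injective _≡_ _≡_ finToPoint
  finToPoint-injective {i} {j} eq = begin
    i                             ≡⟨ sym (funToFin-finToFin {k} {n} i) ⟩
    funToFin (finToFun {n} {k} i) ≡⟨ funToFin-cong finToFun-agree ⟩
    funToFin (finToFun {n} {k} j) ≡⟨ funToFin-finToFin {k} {n} j ⟩
    j                             ∎
    where
    open ≡-Reasoning
    finToFun-agree : finToFun {n} {k} i ≗ finToFun j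
    finToFun-agree x = begin
      finToFun i x              ≡⟨ sym (lookup∘tabulate (finToFun i) x) ⟩
      lookup (finToPoint i) x   ≡⟨ cong (λ P → lookup P x) eq ⟩
      lookup (finToPoint j) x   ≡⟨ lookup∘tabulate (finToFun j) x ⟩
      finToFun j x              ∎

  allPoints : List (Point n k)
  allPoints = map finToPoint (allFin (n ^ k))

  ∈-allPoints : ∀ P → P ∈ allPoints
  ∈-allPoints P = subst (_∈ allPoints) (finToPoint-pointToFin P) (∈-map⁺ finToPoint (∈-allFin (pointToFin P)))

  allPoints-unique : Unique allPoints
  allPoints-unique = Unique-map⁺ finToPoint-injective (allFin⁺ (n ^ k))

  length-allPoints : length allPoints ≡ n ^ k
  length-allPoints = trans (length-map finToPoint (allFin (n ^ k))) (length-tabulate (λ i → i))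

Exhaustible : Set → Set₁
Exhaustible A = ∀ {P : Pred A 0ℓ} → Decidable P → Dec (∃ P)

exhaustible-listed : ∀ {A : Set} (xs : List A) → (∀ x → x ∈ xs) → Exhaustible A
exhaustible-listed xs ∈xs P? = map′ satisfied (λ (x , px) → lose (∈xs x) px) (Any.any? P? xs)

exhaustible⇒all? : ∀ {A : Set} → Exhaustible A → {P : Pred A 0ℓ} → Decidable P → Dec (∀ x → P x)
exhaustible⇒all? search P? =
  map′ (λ ∄counterexample x → decidable-stable (P? x) (λ ¬px → ∄counterexample (x , ¬px)))
       (λ ∀P (x , ¬px) → ¬px (∀P x))
       (¬? (search (¬? ∘ P?)))

anyOfLength? : ∀ {A : Set} → Exhaustible A → ∀ m {P : Pred (List A) 0ℓ} → Decidable P →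
               Dec (∃ λ xs → length xs ≡ m × P xs)
anyOfLength? search zero    P? = map′ (λ p → [] , refl , p) (λ { ([] , refl , p) → p }) (P? [])
anyOfLength? search (suc m) P? =
  map′ (λ (x , xs , len≡m , p) → x ∷ xs , cong suc len≡m , p)
       (λ { (x ∷ xs , len≡1+m , p) → x , xs , suc-injective len≡1+m , p })
       (search (λ x → anyOfLength? search m (P? ∘ (x ∷_))))

exhaustible-Point : ∀ {n k} → Exhaustible (Point n k)
exhaustible-Point = exhaustible-listed allPoints ∈-allPoints

exhaustible-Rook : ∀ {n k ℓ} → Exhaustible (Rook n k ℓ)
exhaustible-Rook {ℓ = ℓ} {P} P? =
  map′ (λ (p , d , s , q) → rook p d s , q) (λ (rook p d s , q) → p , d , s , q)
       (exhaustible-Point (λ p → anySubset? (ofSize? p)))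
  where
  ofSize? : ∀ p d → Dec (Σ (card d ≡ ℓ) λ s → P (rook p d s))
  ofSize? p d with card d ℕ.≟ ℓ
  ... | no  ≢ℓ = no (≢ℓ ∘ proj₁)
  ... | yes s  = map′ (s ,_) (λ (s′ , q) → subst (P ∘ rook p d) (≡-irrelevant s′ s) q) (P? (rook p d s))

module _ {P : Pred ℕ 0ℓ} (P? : Decidable P) where

  Least : ℕ → Set
  Least a = P a × (∀ b → b < a → ¬ P b)

  least-below : ∀ N → ∃ Least ⊎ (∀ b → b < N → ¬ P b)
  least-below zero = inj₂ (λ _ ())
  least-below (suc N) with least-below N
  ... | inj₁ least = inj₁ least
  ... | inj₂ none with P? N
  ...   | yes p = inj₁ (N , p , none)
  ...   | no ¬p = inj₂ λ b b<1+N → below-or-equal b (m<1+n⇒m<n∨m≡n b<1+N)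
    where
    below-or-equal : ∀ b → b < N ⊎ b ≡ N → ¬ P b
    below-or-equal b (inj₁ b<N) = none b b<N
    below-or-equal b (inj₂ refl) = ¬p

  least-exists : ∀ {N} → P N → ∃ Least
  least-exists {N} p with least-below (suc N)
  ... | inj₁ least = least
  ... | inj₂ none  = contradiction p (none N (n<1+n N))

module _ {n k ℓ : ℕ} where

  covers? : ∀ (r : Rook n k ℓ) → Decidable (Covers r)
  covers? r Q = ≡-dec _≟_ Q (pos r) ⊎-dec
    any? (λ i → (i ∈ₛ? dirs r) ×-dec ¬? (lookup Q i ≟ lookup (pos r) i) ×-dec
                all? (λ j → ¬? (j ≟ i) →-dec (lookup Q j ≟ lookup (pos r) j)))

  isCovering? : Decidable (IsCovering {n} {k} {ℓ})
  isCovering? rs = unique? (map pos rs) ×-dec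
    exhaustible⇒all? exhaustible-Point (λ Q → Any.any? (λ r → covers? r Q) rs)
    where open UniqueDec (≡-dec (_≟_ {n})) using (unique?)

  CoveringOfSize : ℕ → Set
  CoveringOfSize m = Σ (List (Rook n k ℓ)) λ rs → IsCovering rs × length rs ≡ m

  coveringOfSize? : Decidable CoveringOfSize
  coveringOfSize? m =
    map′ (λ (rs , len≡m , cov) → rs , cov , len≡m) (λ (rs , cov , len≡m) → rs , len≡m , cov)
         (anyOfLength? exhaustible-Rook m isCovering?)

  minCover-exists : ∀ rs → IsCovering rs → ∃ λ a → IsMinCover n k ℓ a × a ≤ length rs
  minCover-exists rs cov with least-exists coveringOfSize? (rs , cov , refl)
  ... | a , covering , noneSmaller =
    a , (covering , minimal) , minimal rs cov
    where
    minimal : ∀ rs′ → IsCovering rs′ → a ≤ length rs′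
    minimal rs′ cov′ = ≮⇒≥ (λ len<a → noneSmaller (length rs′) len<a (rs′ , cov′ , refl))

elements : ∀ {k} → Subset k → List (Fin k)
elements []            = []
elements (inside ∷ d)  = Fin.zero ∷ map Fin.suc (elements d)
elements (outside ∷ d) = map Fin.suc (elements d)

length-elements : ∀ {k} (d : Subset k) → length (elements d) ≡ card d
length-elements []            = refl
length-elements (inside ∷ d)  = cong suc (trans (length-map Fin.suc (elements d)) (length-elements d))
length-elements (outside ∷ d) = trans (length-map Fin.suc (elements d)) (length-elements d)

∈-elements : ∀ {k} (d : Subset k) {i} → i ∈ₛ d → i ∈ elements d
∈-elements (inside ∷ d)  Vec.here      = here refl
∈-elements (inside ∷ d)  (Vec.there p) = there (∈-map⁺ Fin.suc (∈-elements d p))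
∈-elements (outside ∷ d) (Vec.there p) = ∈-map⁺ Fin.suc (∈-elements d p)

length-concatMap : ∀ {A B : Set} (f : A → List B) {c} → (∀ x → length (f x) ≡ c) →
                   ∀ xs → length (concatMap f xs) ≡ length xs * c
length-concatMap f len-f []       = refl
length-concatMap f len-f (x ∷ xs) =
  trans (length-++ (f x)) (cong₂ _+_ (len-f x) (length-concatMap f len-f xs))

injection⇒≤length : ∀ {A : Set} {m} {xs : List A} (f : Fin m → A) → Injective _≡_ _≡_ f →
                    (∀ i → f i ∈ xs) → m ≤ length xs
injection⇒≤length {xs = xs} f f-injective f∈xs = injective⇒≤ position-injective
  where
  position-injective : Injective _≡_ _≡_ (Any.index ∘ f∈xs)
  position-injective {i} {j} eq = f-injective (begin
    f i                                 ≡⟨ lookup-index (f∈xs i) ⟩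
    List.lookup xs (Any.index (f∈xs i)) ≡⟨ cong (List.lookup xs) eq ⟩
    List.lookup xs (Any.index (f∈xs j)) ≡⟨ sym (lookup-index (f∈xs j)) ⟩
    f j                                 ∎)
    where open ≡-Reasoning

≡-update : ∀ {A : Set} {k} {P Q : Vec A k} i →
           (∀ j → j ≢ i → lookup Q j ≡ lookup P j) → Q ≡ P [ i ]≔ lookup Q i
≡-update {P = P} {Q} i agree =
  trans (sym (tabulate∘lookup Q)) (trans (tabulate-cong pointwise) (tabulate∘lookup (P [ i ]≔ lookup Q i)))
  where
  pointwise : ∀ j → lookup Q j ≡ lookup (P [ i ]≔ lookup Q i) j
  pointwise j with j ≟ i
  ... | yes refl = sym (lookup∘update i P (lookup Q i))
  ... | no  j≢i  = trans (agree j j≢i) (sym (lookup∘update′ j≢i P (lookup Q i)))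

module _ {n′ k ℓ : ℕ} where

  neighbours : Point (suc n′) k → Fin k → List (Point (suc n′) k)
  neighbours P i = map (λ v → P [ i ]≔ punchIn (lookup P i) v) (allFin n′)

  length-neighbours : ∀ P i → length (neighbours P i) ≡ n′
  length-neighbours P i = trans (length-map _ (allFin n′)) (length-tabulate (λ v → v))

  ∈-neighbours : ∀ {P Q} i → lookup Q i ≢ lookup P i → (∀ j → j ≢ i → lookup Q j ≡ lookup P j) →
                 Q ∈ neighbours P i
  ∈-neighbours {P} {Q} i Qᵢ≢Pᵢ agree =
    subst (_∈ neighbours P i) (sym Q≡neighbour) (∈-map⁺ _ (∈-allFin (punchOut Pᵢ≢Qᵢ)))
    where
    Pᵢ≢Qᵢ : lookup P i ≢ lookup Q i
    Pᵢ≢Qᵢ = Qᵢ≢Pᵢ ∘ sym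
    Q≡neighbour : Q ≡ P [ i ]≔ punchIn (lookup P i) (punchOut Pᵢ≢Qᵢ)
    Q≡neighbour = trans (≡-update i agree) (cong (P [ i ]≔_) (sym (punchIn-punchOut Pᵢ≢Qᵢ)))

  coveredPoints : Rook (suc n′) k ℓ → List (Point (suc n′) k)
  coveredPoints r = pos r ∷ concatMap (neighbours (pos r)) (elements (dirs r))

  length-coveredPoints : ∀ r → length (coveredPoints r) ≡ suc (ℓ * n′)
  length-coveredPoints r = cong suc (begin
    length (concatMap (neighbours (pos r)) (elements (dirs r)))
      ≡⟨ length-concatMap (neighbours (pos r)) (length-neighbours (pos r)) (elements (dirs r)) ⟩
    length (elements (dirs r)) * n′
      ≡⟨ cong (_* n′) (trans (length-elements (dirs r)) (size r)) ⟩
    ℓ * n′ ∎)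
    where open ≡-Reasoning

  covers⇒∈coveredPoints : ∀ r {Q} → Covers r Q → Q ∈ coveredPoints r
  covers⇒∈coveredPoints r (inj₁ Q≡pos) = here Q≡pos
  covers⇒∈coveredPoints r (inj₂ (i , i∈dirs , Qᵢ≢Pᵢ , agree)) =
    there (∈-concatMap⁺ (neighbours (pos r)) (lose (∈-elements (dirs r) i∈dirs) (∈-neighbours i Qᵢ≢Pᵢ agree)))

  covering⇒lowerBound : ∀ rs → IsCovering rs → suc n′ ^ k ≤ length rs * (ℓ * n′ + 1)
  covering⇒lowerBound rs (_ , cover) = ≤-trans
    (injection⇒≤length (finToPoint {suc n′} {k}) finToPoint-injective
      (λ i → ∈-concatMap⁺ coveredPoints (Any.map (λ {r} → covers⇒∈coveredPoints r) (cover (finToPoint i)))))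
    (≤-reflexive (trans (length-concatMap coveredPoints length-coveredPoints rs)
                        (cong (length rs *_) (+-comm 1 (ℓ * n′)))))

initialSegment : ∀ {k} m → m ≤ k → Subset k
initialSegment zero    _         = ⊥
initialSegment (suc m) (s≤s m≤k) = inside ∷ initialSegment m m≤k

card-initialSegment : ∀ {k} m (m≤k : m ≤ k) → card (initialSegment m m≤k) ≡ m
card-initialSegment {k} zero    _         = ∣⊥∣≡0 k
card-initialSegment     (suc m) (s≤s m≤k) = cong suc (card-initialSegment m m≤k)

module _ {n′ k ℓ : ℕ} (ℓ≤k : ℓ ≤ k) where

  columnRook : Point (suc n′) k → Rook (suc n′) (suc k) (suc ℓ)
  columnRook v = rook (Fin.zero ∷ v) (initialSegment (suc ℓ) (s≤s ℓ≤k)) (card-initialSegment (suc ℓ) (s≤s ℓ≤k))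

  columnRook-covers : ∀ Q → Covers (columnRook (Vec.tail Q)) Q
  columnRook-covers (Fin.zero  ∷ v) = inj₁ refl
  columnRook-covers (Fin.suc t ∷ v) = inj₂ (Fin.zero , Vec.here , (λ ()) , agree)
    where
    agree : ∀ j → j ≢ Fin.zero → lookup (Fin.suc t ∷ v) j ≡ lookup (Fin.zero ∷ v) j
    agree Fin.zero    0≢0 = contradiction refl 0≢0
    agree (Fin.suc j) _   = refl

  columnRooks : List (Rook (suc n′) (suc k) (suc ℓ))
  columnRooks = map columnRook allPoints

  columnRooks-covering : IsCovering columnRooks
  columnRooks-covering =
    subst Unique (map-∘ allPoints) (Unique-map⁺ ∷-injectiveʳ allPoints-unique) ,
    λ Q → lose (∈-map⁺ columnRook (∈-allPoints (Vec.tail Q))) (columnRook-covers Q)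

  length-columnRooks : length columnRooks ≡ suc n′ ^ k
  length-columnRooks = trans (length-map columnRook allPoints) (length-allPoints {suc n′} {k})

theorem2 : ∀ (n k ℓ : ℕ) → 1 ≤ n → 1 ≤ ℓ → ℓ ≤ k →
    ∃ λ (a : ℕ) → IsMinCover n k ℓ a
    × (n ^ k ≤ a * (ℓ * (n ∸ 1) + 1))
    × (a ≤ n ^ (k ∸ 1))
-- For n = suc n′ and k = suc k′, n ∸ 1 and k ∸ 1 reduce to n′ and k′.
theorem2 (suc n′) (suc k′) (suc ℓ′) _ _ (s≤s ℓ′≤k′)
  with minCover-exists (columnRooks ℓ′≤k′) (columnRooks-covering ℓ′≤k′)
... | a , isMin@((rs , cov , len≡a) , _) , a≤columns =
  a , isMin ,
  subst (λ m → suc n′ ^ suc k′ ≤ m * (suc ℓ′ * n′ + 1)) len≡a (covering⇒lowerBound rs cov) ,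
  ≤-trans a≤columns (≤-reflexive (length-columnRooks ℓ′≤k′))
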